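{- Let $P$ be a graded tree poset of height $k$. Then there exist an integer $\ell\ge 1$ and maximal chains $C_1,\dots,C_\ell$ of $P$ such that: (i) for all $1\le j\le \ell$, the subposet $\bigcup_{i=1}^{j}C_i$ of $P$ is a graded poset of height $k$, and $\bigcup_{i=1}^{\ell}C_i=P$; (ii) for all $1<j\le \ell$, the set $I_j:=C_j\setminus\bigcup_{i=1}^{j-1}C_i$ is a nonempty interval of $P$ containing a minimal or maximal element of $P$; (iii) for all $1<j\le\ell$, $C_j\setminus I_j\subseteq C_i$ for some $1\le i<j$.
   Context: All posets are finite. The Hasse diagram of a poset is the graph joining $x,y$ when one covers the other. A tree poset is one whose Hasse diagram is a tree; its height is the number of elements of a longest chain; a poset is graded if all its maximal chains have the same number of elements. An interval of $P$ is a set of the form $\{z\in P: x\le z\le y\}$ with $x,y\in P$. -}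

module Defs where

open import Level using (0ℓ)
open import Data.Nat using (ℕ; zero; suc; _≤_; _<_)
open import Data.Fin using (Fin)
open import Data.Fin.Subset using (Subset; _∈_; _⊆_; _∪_; _─_; ⊥; ⊤; ∣_∣; Nonempty)
open import Data.List using (List; []; _∷_; _++_; [_]; length)
open import Data.List.Relation.Unary.Unique.Propositional using (Unique)
open import Data.List.Relation.Unary.Linked using (Linked)
open import Data.Product using (Σ; ∃; ∃-syntax; _×_; _,_)
open import Data.Sum using (_⊎_)
open import Relation.Binary.PropositionalEquality using (_≡_; _≢_)
open import Relation.Binary.Structures using (IsDecPartialOrder)
open import Relation.Nullary using (¬_)

record FinPoset (n : ℕ) : Set₁ where
  field
    _≼_ : Fin n → Fin n → Set
    isDecPartialOrder : IsDecPartialOrder _≡_ _≼_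

module _ {n : ℕ} (P : FinPoset n) where
  open FinPoset P

  _≺_ : Fin n → Fin n → Set
  x ≺ y = x ≼ y × x ≢ y

  Covers : Fin n → Fin n → Set
  Covers x y = x ≺ y × (∀ z → x ≼ z → z ≼ y → z ≡ x ⊎ z ≡ y)

  HasseAdj : Fin n → Fin n → Set
  HasseAdj x y = Covers x y ⊎ Covers y x

  data Walk : Fin n → Fin n → Set where
    here : ∀ {x} → Walk x x
    step : ∀ {x y z} → HasseAdj x y → Walk y z → Walk x z

  HasseConnected : Set
  HasseConnected = ∀ x y → Walk x y

  -- a cycle: at least 3 distinct vertices, consecutive ones adjacent, closing up
  HasseCycle : Set
  HasseCycle = ∃[ x ] ∃[ ys ] (2 ≤ length ys × Unique (x ∷ ys) × Linked HasseAdj (x ∷ ys ++ [ x ]))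

  IsTreePoset : Set
  IsTreePoset = 0 < n × HasseConnected × ¬ HasseCycle

  IsChainIn : Subset n → Subset n → Set
  IsChainIn S C = C ⊆ S × (∀ {x y} → x ∈ C → y ∈ C → x ≼ y ⊎ y ≼ x)

  IsMaximalChainIn : Subset n → Subset n → Set
  IsMaximalChainIn S C = IsChainIn S C × (∀ D → IsChainIn S D → C ⊆ D → D ⊆ C)

  -- height: number of elements of a longest chain
  HasHeight : Subset n → ℕ → Set
  HasHeight S k = (∃[ C ] (IsChainIn S C × ∣ C ∣ ≡ k)) × (∀ C → IsChainIn S C → ∣ C ∣ ≤ k)

  IsGraded : Subset n → Set
  IsGraded S = ∀ C D → IsMaximalChainIn S C → IsMaximalChainIn S D → ∣ C ∣ ≡ ∣ D ∣

  IsMaximalChain : Subset n → Set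
  IsMaximalChain = IsMaximalChainIn ⊤

  IsInterval : Subset n → Set
  IsInterval I = ∃[ x ] ∃[ y ] (∀ z → (z ∈ I → x ≼ z × z ≼ y) × (x ≼ z → z ≼ y → z ∈ I))

  IsMinimal : Fin n → Set
  IsMinimal x = ∀ y → y ≼ x → y ≡ x

  IsMaximal : Fin n → Set
  IsMaximal x = ∀ y → x ≼ y → y ≡ x

-- ⋃_{i=1}^{j} C i  (sequence indexed from 1; C 0 is unused)
unionUpTo : {n : ℕ} → (ℕ → Subset n) → ℕ → Subset n
unionUpTo C zero = ⊥
unionUpTo C (suc j) = unionUpTo C j ∪ C (suc j)

-- I_j := C_j \ ⋃_{i=1}^{j-1} C_i  (used for j ≥ 2)
newPart : {n : ℕ} → (ℕ → Subset n) → ℕ → Subset n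
newPart C zero = C zero
newPart C (suc j) = C (suc j) ─ unionUpTo C j

module Submission where

-- In a tree poset a Hasse-connected set W is convex: if x ≤ z ≤ y with x, y ∈ W and z ∉ W, a
-- saturated chain from x through z to y leaves W and comes back, and with a simple path inside W
-- it closes a cycle of the Hasse diagram. Hence a Hasse-connected union U of maximal chains is
-- graded of height k: a maximal chain of U contains a minimal and a maximal element of P, and by
-- convexity nothing of P can be inserted into it. The chains are added greedily. While U ≠ P, a
-- Hasse edge joins some u ∈ U, lying on an earlier chain C_i, to some v ∉ U. If v covers u, the new
-- chain is C_i below u followed by a saturated chain from v up to a maximal element m; by convexity
-- of U the segment [v, m] misses U, so it is exactly the new part I_j, and the rest lies in C_i.
-- If u covers v the construction is dual. U grows strictly, so the process ends with U = P.

open import Defs hiding (_≺_)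
open import Data.Nat using (ℕ; _≤_; _<_; zero; suc; z≤n; s≤s; s≤s⁻¹)
import Data.Nat as ℕ
open import Data.Nat.Properties using (≤-refl; ≤-trans; <⇒≤; <⇒≱; <⇒≢; m≤n⇒m≤1+n; m≤n⇒m<n∨m≡n)
open import Data.Fin.Subset
  using (Subset; ⊤; _⊆_; _─_; _∈_; Nonempty; ⊥; _∪_; _∩_; _⊂_; _⊃_; ⁅_⁆; _∉_; ∣_∣; inside)
open import Data.Product using (∃-syntax; _×_; ∃; _,_; proj₁; proj₂)
open import Data.Sum using (_⊎_; inj₁; inj₂; [_,_]′)
open import Relation.Binary.PropositionalEquality using (_≡_; _≢_; refl; sym; trans; subst; cong₂)

open import Data.Empty using (⊥-elim)
open import Data.Fin using (Fin; fromℕ<)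
open import Data.Fin.Induction using (po-wellFounded; po-noetherian)
open import Data.Fin.Properties using (any?; all?; ¬∀⟶∃¬)
open import Data.Fin.Subset.Induction using (⊃-wellFounded)
open import Data.Fin.Subset.Properties
  using (_∈?_; ∈⊤; ⊆⊤; ∉⊥; ⊆-antisym; nonempty?; p⊂q⇒∣p∣<∣q∣; x∈⁅x⁆; x∈⁅y⁆⇒x≡y; ∪-identityˡ;
         p⊆p∪q; q⊆p∪q; x∈p∪q⁺; x∈p∪q⁻; p∩q⊆p; p∩q⊆q; x∈p∩q⁺; p─q⊆p; x∈p∧x∉q⇒x∈p─q)
open import Data.List using (List; []; _∷_; _++_; [_]; length)
open import Data.List.Properties using (++-assoc)
open import Data.List.Membership.Propositional using () renaming (_∈_ to _∈ₗ_)
open import Data.List.Membership.Propositional.Properties using (∈-++⁺ˡ; ∈-++⁺ʳ; ∈-++⁻)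
open import Data.List.Relation.Binary.Disjoint.Propositional using (Disjoint)
open import Data.List.Relation.Unary.All as All using (All; []; _∷_)
import Data.List.Relation.Unary.All.Properties as Allₚ
open import Data.List.Relation.Unary.AllPairs using ([]; _∷_)
open import Data.List.Relation.Unary.Any using (here; there)
open import Data.List.Relation.Unary.Linked using (Linked; [-]; _∷_)
open import Data.List.Relation.Unary.Unique.Propositional using (Unique)
import Data.List.Relation.Unary.Unique.Propositional.Properties as Uniqueₚ
import Data.Product as Σ
import Data.Sum as Sum
import Data.Vec as Vec
open import Function using (flip; id; _∘_)
open import Induction.WellFounded using (Acc; acc)
open import Relation.Binary.Definitions using (DecidableEquality)
open import Relation.Binary.Structures using (IsDecPartialOrder)
import Relation.Binary.Construct.Flip.EqAndOrd as Flip
import Relation.Binary.Construct.NonStrictToStrict as ToStrict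
open import Relation.Nullary using (¬_; Dec; yes; no; _×-dec_)
open import Relation.Unary using (Decidable; ∁)

module _ {A : Set} where

  -- Path R x y vs: an R-path from x to y; vs lists its vertices after x.
  data Path (R : A → A → Set) : A → A → List A → Set where
    [] : ∀ {x} → Path R x x []
    _∷_ : ∀ {x y z vs} → R x y → Path R y z vs → Path R x z (y ∷ vs)

  module _ {R : A → A → Set} where

    _++ₚ_ : ∀ {x y z as bs} → Path R x y as → Path R y z bs → Path R x z (as ++ bs)
    [] ++ₚ q = q
    (r ∷ p) ++ₚ q = r ∷ (p ++ₚ q)

    mapₚ : ∀ {S : A → A → Set} → (∀ {a b} → R a b → S a b) →
           ∀ {x y vs} → Path R x y vs → Path S x y vs
    mapₚ f [] = []
    mapₚ f (r ∷ p) = f r ∷ mapₚ f p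

    linked : ∀ {x y vs} → Path R x y vs → Linked R (x ∷ vs)
    linked [] = [-]
    linked (r ∷ []) = r ∷ [-]
    linked (r ∷ p@(_ ∷ _)) = r ∷ linked p

    target∈ : ∀ {x y vs} → Path R x y vs → y ∈ₗ x ∷ vs
    target∈ [] = here refl
    target∈ (r ∷ p) = there (target∈ p)

    prefix : ∀ {Q : A → Set} {x y w vs} → All Q vs → Path R x y vs → w ∈ₗ x ∷ vs →
             ∃[ as ] (Path R x w as × All Q as)
    prefix _ p (here refl) = [] , [] , []
    prefix (q ∷ qs) (r ∷ p) (there m) = Σ.map (_ ∷_) (Σ.map (r ∷_) (q ∷_)) (prefix qs p m)

    suffix : ∀ {Q : A → Set} {x y w vs} → All Q vs → Path R x y vs → w ∈ₗ x ∷ vs →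
             ∃[ bs ] (Path R w y bs × All Q bs)
    suffix qs p (here refl) = _ , p , qs
    suffix (_ ∷ qs) (_ ∷ p) (there m) = suffix qs p m

    firstIn : ∀ {Q : A → Set} → Decidable Q → ∀ {x y vs} → ¬ Q x → Q y → Path R x y vs →
              ∃[ y′ ] ∃[ bs ] (Q y′ × Path R x y′ (bs ++ [ y′ ]) × All (∁ Q) bs)
    firstIn Q? ¬Qx Qy [] = ⊥-elim (¬Qx Qy)
    firstIn Q? ¬Qx Qy (_∷_ {y = z} r p) with Q? z
    ... | yes Qz = z , [] , Qz , r ∷ [] , []
    ... | no ¬Qz = Σ.map id (Σ.map (z ∷_) (Σ.map id (Σ.map (r ∷_) (¬Qz ∷_)))) (firstIn Q? ¬Qz Qy p)

  module _ {R : A → A → Set} (R-sym : ∀ {a b} → R a b → R b a) where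

    reverse : ∀ {Q : A → Set} {x y vs} → Q x → All Q vs → Path R x y vs →
              ∃[ ws ] (Path R y x ws × All Q ws)
    reverse Qx [] [] = [] , [] , []
    reverse Qx (Qy ∷ Qvs) (r ∷ p) with reverse Qy Qvs p
    ... | ws , q , Qws = ws ++ [ _ ] , q ++ₚ (R-sym r ∷ []) , Allₚ.++⁺ Qws (Qx ∷ [])

  module _ {R : A → A → Set} (_≟ₐ_ : DecidableEquality A) where
    open import Data.List.Membership.DecPropositional _≟ₐ_ using () renaming (_∈?_ to _∈ₗ?_)

    eraseLoops : ∀ {Q : A → Set} {x y vs} → All Q vs → Path R x y vs →
                 ∃[ ws ] (Path R x y ws × Unique (x ∷ ws) × All Q ws)
    eraseLoops [] [] = [] , [] , [] ∷ [] , []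
    eraseLoops {x = x} (Qy ∷ Qvs) (_∷_ {y = y} r p) with eraseLoops Qvs p
    ... | ws , q , u , Qws with x ∈ₗ? y ∷ ws
    ...   | no x∉ = y ∷ ws , r ∷ q , Allₚ.¬Any⇒All¬ _ x∉ ∷ u , Qy ∷ Qws
    ...   | yes x∈ = dropUntil x∈ q u Qws
      where
      dropUntil : ∀ {Q : A → Set} {a c b vs} → a ∈ₗ c ∷ vs → Path R c b vs → Unique (c ∷ vs) → All Q vs →
                  ∃[ ws ] (Path R a b ws × Unique (a ∷ ws) × All Q ws)
      dropUntil (here refl) p u Qvs = _ , p , u , Qvs
      dropUntil (there m) (_ ∷ p) (_ ∷ u) (_ ∷ Qvs) = dropUntil m p u Qvs

2≤length : ∀ {A : Set} (xs : List A) {y w : A} ws → 2 ≤ length ((xs ++ [ y ]) ++ w ∷ ws)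
2≤length [] ws = s≤s (s≤s z≤n)
2≤length (x ∷ xs) ws = s≤s (≤-trans (s≤s z≤n) (2≤length xs ws))

fromList : ∀ {n} → List (Fin n) → Subset n
fromList [] = ⊥
fromList (x ∷ xs) = ⁅ x ⁆ ∪ fromList xs

module _ {n : ℕ} {x : Fin n} where

  ∈-fromList⁺ : ∀ {xs} → x ∈ₗ xs → x ∈ fromList xs
  ∈-fromList⁺ (here refl) = x∈p∪q⁺ (inj₁ (x∈⁅x⁆ x))
  ∈-fromList⁺ (there m) = x∈p∪q⁺ (inj₂ (∈-fromList⁺ m))

  ∈-fromList⁻ : ∀ {xs} → x ∈ fromList xs → x ∈ₗ xs
  ∈-fromList⁻ {[]} m = ⊥-elim (∉⊥ m)
  ∈-fromList⁻ {y ∷ ys} m with x∈p∪q⁻ ⁅ y ⁆ (fromList ys) m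
  ... | inj₁ x∈y = here (x∈⁅y⁆⇒x≡y y x∈y)
  ... | inj₂ x∈ys = there (∈-fromList⁻ x∈ys)

fromList-++⁺ˡ : ∀ {n} (xs ys : List (Fin n)) → fromList xs ⊆ fromList (xs ++ ys)
fromList-++⁺ˡ xs ys = ∈-fromList⁺ {xs = xs ++ ys} ∘ ∈-++⁺ˡ ∘ ∈-fromList⁻ {xs = xs}

fromList-++⁺ʳ : ∀ {n} (xs ys : List (Fin n)) → fromList ys ⊆ fromList (xs ++ ys)
fromList-++⁺ʳ xs ys = ∈-fromList⁺ {xs = xs ++ ys} ∘ ∈-++⁺ʳ xs ∘ ∈-fromList⁻ {xs = ys}

x∈p─q⇒x∉q : ∀ {n} {x : Fin n} (p q : Subset n) → x ∈ p ─ q → x ∉ q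
x∈p─q⇒x∉q (_ Vec.∷ _) (inside Vec.∷ _) () Vec.here
x∈p─q⇒x∉q (_ Vec.∷ p) (_ Vec.∷ q) (Vec.there x∈) (Vec.there x∈q) = x∈p─q⇒x∉q p q x∈ x∈q

p⊆q∧∣q∣≤∣p∣⇒q⊆p : ∀ {n} {p q : Subset n} → p ⊆ q → ∣ q ∣ ≤ ∣ p ∣ → q ⊆ p
p⊆q∧∣q∣≤∣p∣⇒q⊆p {p = p} p⊆q ∣q∣≤∣p∣ {x} x∈q with x ∈? p
... | yes x∈p = x∈p
... | no x∉p = ⊥-elim (<⇒≱ (p⊂q⇒∣p∣<∣q∣ (p⊆q , x , x∈q , x∉p)) ∣q∣≤∣p∣)

module _ {n : ℕ} {p q r : Subset n} (p⊆q∪r : p ⊆ q ∪ r) where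

  p⊆q∪r⇒p─q⊆r : p ─ q ⊆ r
  p⊆q∪r⇒p─q⊆r x∈ with x∈p∪q⁻ q r (p⊆q∪r (p─q⊆p p q x∈))
  ... | inj₁ x∈q = ⊥-elim (x∈p─q⇒x∉q p q x∈ x∈q)
  ... | inj₂ x∈r = x∈r

  p⊆q∪r⇒p─s≡q : ∀ {s} → q ⊆ p → (∀ {x} → x ∈ q → x ∉ s) → r ⊆ s → p ─ s ≡ q
  p⊆q∪r⇒p─s≡q {s} q⊆p q∩s≡∅ r⊆s =
    ⊆-antisym p─s⊆q (λ x∈q → x∈p∧x∉q⇒x∈p─q (q⊆p x∈q) (q∩s≡∅ x∈q))
    where
    p─s⊆q : p ─ s ⊆ q
    p─s⊆q x∈ with x∈p∪q⁻ q r (p⊆q∪r (p─q⊆p p s x∈))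
    ... | inj₁ x∈q = x∈q
    ... | inj₂ x∈r = ⊥-elim (x∈p─q⇒x∉q p s x∈ (r⊆s x∈r))

m≤1+n⇒m≤n⊎m≡1+n : ∀ {m n} → m ≤ suc n → m ≤ n ⊎ m ≡ suc n
m≤1+n⇒m≤n⊎m≡1+n = Sum.map₁ s≤s⁻¹ ∘ m≤n⇒m<n∨m≡n

module _ {n : ℕ} (C : ℕ → Subset n) where

  ∈-unionUpTo⁺ : ∀ {i j z} → 1 ≤ i → i ≤ j → z ∈ C i → z ∈ unionUpTo C j
  ∈-unionUpTo⁺ {j = zero} (s≤s _) ()
  ∈-unionUpTo⁺ {j = suc j} 1≤i i≤1+j z∈ with m≤1+n⇒m≤n⊎m≡1+n i≤1+j
  ... | inj₁ i≤j = x∈p∪q⁺ (inj₁ (∈-unionUpTo⁺ 1≤i i≤j z∈))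
  ... | inj₂ refl = x∈p∪q⁺ (inj₂ z∈)

  ∈-unionUpTo⁻ : ∀ j {z} → z ∈ unionUpTo C j → ∃[ i ] (1 ≤ i × i ≤ j × z ∈ C i)
  ∈-unionUpTo⁻ zero z∈ = ⊥-elim (∉⊥ z∈)
  ∈-unionUpTo⁻ (suc j) z∈ with x∈p∪q⁻ (unionUpTo C j) (C (suc j)) z∈
  ... | inj₁ z∈U = Σ.map id (Σ.map id (Σ.map m≤n⇒m≤1+n id)) (∈-unionUpTo⁻ j z∈U)
  ... | inj₂ z∈C = suc j , s≤s z≤n , ≤-refl , z∈C

module _ {n : ℕ} {C D : ℕ → Subset n} where

  unionUpTo-cong : ∀ j → (∀ {i} → i ≤ j → C i ≡ D i) → unionUpTo C j ≡ unionUpTo D j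
  unionUpTo-cong zero _ = refl
  unionUpTo-cong (suc j) C≗D = cong₂ _∪_ (unionUpTo-cong j (C≗D ∘ m≤n⇒m≤1+n)) (C≗D ≤-refl)

  newPart-cong : ∀ j → (∀ {i} → i ≤ j → C i ≡ D i) → newPart C j ≡ newPart D j
  newPart-cong zero C≗D = C≗D z≤n
  newPart-cong (suc j) C≗D = cong₂ _─_ (C≗D ≤-refl) (unionUpTo-cong j (C≗D ∘ m≤n⇒m≤1+n))

module _ {A : Set} where

  _[_]≔_ : (ℕ → A) → ℕ → A → ℕ → A
  (f [ m ]≔ a) i with i ℕ.≟ m
  ... | yes _ = a
  ... | no _ = f i

  []≔-updated : ∀ f m a → (f [ m ]≔ a) m ≡ a
  []≔-updated f m a with m ℕ.≟ m
  ... | yes _ = refl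
  ... | no m≢m = ⊥-elim (m≢m refl)

  []≔-unchanged : ∀ f {m} a {i} → i ≢ m → (f [ m ]≔ a) i ≡ f i
  []≔-unchanged f {m} a {i} i≢m with i ℕ.≟ m
  ... | yes i≡m = ⊥-elim (i≢m i≡m)
  ... | no _ = refl

dual : ∀ {n} → FinPoset n → FinPoset n
dual P = record
  { _≼_ = flip _≼_
  ; isDecPartialOrder = record
    { isPartialOrder = Flip.isPartialOrder isPartialOrder
    ; _≟_ = _≟_
    ; _≤?_ = flip _≤?_
    }
  }
  where
  open FinPoset P
  open IsDecPartialOrder isDecPartialOrder

module Extrema {n : ℕ} (P : FinPoset n) where
  open FinPoset P
  open IsDecPartialOrder isDecPartialOrder using (isPartialOrder; _≟_; _≤?_)
    renaming (refl to ≼-refl; trans to ≼-trans)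

  MaximalIn : Subset n → Fin n → Set
  MaximalIn S m = m ∈ S × (∀ {y} → y ∈ S → m ≼ y → y ≡ m)

  maximalAbove : (S : Subset n) {x : Fin n} → x ∈ S → ∃[ m ] (x ≼ m × MaximalIn S m)
  maximalAbove S {x} = go (po-noetherian isPartialOrder x)
    where
    go : ∀ {x} → Acc (flip (Defs._≺_ P)) x → x ∈ S → ∃[ m ] (x ≼ m × MaximalIn S m)
    go {x} (acc rec) x∈S with any? (λ y → y ∈? S ×-dec ToStrict.<-decidable _≡_ _≼_ _≟_ _≤?_ x y)
    ... | yes (y , y∈S , x≺y) = Σ.map id (Σ.map₁ (≼-trans (proj₁ x≺y))) (go (rec x≺y) y∈S)
    ... | no nothing-above = x , ≼-refl , x∈S , maximal
      where
      maximal : ∀ {y} → y ∈ S → x ≼ y → y ≡ x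
      maximal {y} y∈S x≼y with y ≟ x
      ... | yes y≡x = y≡x
      ... | no y≢x = ⊥-elim (nothing-above (y , y∈S , x≼y , y≢x ∘ sym))

module Order {n : ℕ} (P : FinPoset n) where
  open FinPoset P public using (_≼_)
  open FinPoset P using (isDecPartialOrder)
  open IsDecPartialOrder isDecPartialOrder public using (_≟_; _≤?_)
    renaming (refl to ≼-refl; reflexive to ≼-reflexive; trans to ≼-trans; antisym to ≼-antisym)
  open IsDecPartialOrder isDecPartialOrder using (isPartialOrder)
  open Extrema P public using (maximalAbove)
  open Extrema (dual P) public using () renaming (maximalAbove to minimalBelow)

  infix 4 _≺_ _⋖_

  _≺_ : Fin n → Fin n → Set
  _≺_ = Defs._≺_ P

  _⋖_ : Fin n → Fin n → Set
  _⋖_ = Covers P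

  CoverPath : Fin n → Fin n → List (Fin n) → Set
  CoverPath = Path _⋖_

  _≺?_ : ∀ x y → Dec (x ≺ y)
  _≺?_ = ToStrict.<-decidable _≡_ _≼_ _≟_ _≤?_

  ≺-trans : ∀ {x y z} → x ≺ y → y ≺ z → x ≺ z
  ≺-trans = ToStrict.<-trans _≡_ _≼_ isPartialOrder

  ≺⇒⋡ : ∀ {x y} → x ≺ y → ¬ y ≼ x
  ≺⇒⋡ = ToStrict.<⇒≱ _≡_ _≼_ ≼-antisym

  ≼⇒≺⊎≡ : ∀ {x y} → x ≼ y → x ≺ y ⊎ x ≡ y
  ≼⇒≺⊎≡ {x} {y} x≼y with x ≟ y
  ... | yes x≡y = inj₂ x≡y
  ... | no x≢y = inj₁ (x≼y , x≢y)

  comparable⇒≼maximal : ∀ {e t} → IsMaximal P t → e ≼ t ⊎ t ≼ e → e ≼ t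
  comparable⇒≼maximal t-max = [ id , ≼-reflexive ∘ t-max _ ]′

  comparable⇒minimal≼ : ∀ {b e} → IsMinimal P b → b ≼ e ⊎ e ≼ b → b ≼ e
  comparable⇒minimal≼ b-min = [ id , ≼-reflexive ∘ sym ∘ b-min _ ]′

  BoundedByExtrema : Subset n → Set
  BoundedByExtrema U = ∀ {u} → u ∈ U →
    (∃[ b ] (b ∈ U × b ≼ u × IsMinimal P b)) × (∃[ t ] (t ∈ U × u ≼ t × IsMaximal P t))

  coverAbove : ∀ {x y} → x ≺ y → ∃[ c ] (x ⋖ c × c ≼ y)
  coverAbove {x} {y} = go (po-wellFounded isPartialOrder y)
    where
    go : ∀ {y} → Acc _≺_ y → x ≺ y → ∃[ c ] (x ⋖ c × c ≼ y)
    go {y} (acc rec) x≺y with any? (λ z → x ≺? z ×-dec z ≺? y)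
    ... | yes (z , x≺z , z≺y) = Σ.map id (Σ.map₂ (λ c≼z → ≼-trans c≼z (proj₁ z≺y))) (go (rec z≺y) x≺z)
    ... | no nothing-between = y , (x≺y , y-covers) , ≼-refl
      where
      y-covers : ∀ z → x ≼ z → z ≼ y → z ≡ x ⊎ z ≡ y
      y-covers z x≼z z≼y with ≼⇒≺⊎≡ x≼z | ≼⇒≺⊎≡ z≼y
      ... | inj₂ x≡z | _ = inj₁ (sym x≡z)
      ... | inj₁ _ | inj₂ z≡y = inj₂ z≡y
      ... | inj₁ x≺z | inj₁ z≺y = ⊥-elim (nothing-between (z , x≺z , z≺y))

  coverPath : ∀ {x y} → x ≼ y → ∃[ vs ] CoverPath x y vs
  coverPath {x} {y} = go (po-noetherian isPartialOrder x)
    where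
    go : ∀ {x} → Acc (flip _≺_) x → x ≼ y → ∃[ vs ] CoverPath x y vs
    go (acc rec) x≼y with ≼⇒≺⊎≡ x≼y
    ... | inj₂ refl = [] , []
    ... | inj₁ x≺y with coverAbove x≺y
    ...   | c , x⋖c , c≼y = Σ.map (c ∷_) (x⋖c ∷_) (go (rec (proj₁ x⋖c)) c≼y)

  coverPathToMaximal : ∀ x → ∃[ t ] ∃[ vs ] (IsMaximal P t × CoverPath x t vs)
  coverPathToMaximal x with maximalAbove ⊤ ∈⊤
  ... | t , x≼t , _ , t-max = t , Σ.map id (λ p → (λ y → t-max ∈⊤) , p) (coverPath x≼t)

  coverPathFromMinimal : ∀ x → ∃[ b ] ∃[ vs ] (IsMinimal P b × CoverPath b x vs)
  coverPathFromMinimal x with minimalBelow ⊤ ∈⊤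
  ... | b , b≼x , _ , b-min = b , Σ.map id (λ p → (λ y → b-min ∈⊤) , p) (coverPath b≼x)

  coverPath-above : ∀ {x y vs} → CoverPath x y vs → All (x ≺_) vs
  coverPath-above [] = []
  coverPath-above (x⋖z ∷ p) = proj₁ x⋖z ∷ All.map (≺-trans (proj₁ x⋖z)) (coverPath-above p)

  coverPath-≼ : ∀ {x y vs} → CoverPath x y vs → x ≼ y
  coverPath-≼ [] = ≼-refl
  coverPath-≼ (x⋖z ∷ p) = ≼-trans (proj₁ (proj₁ x⋖z)) (coverPath-≼ p)

  coverPath-between : ∀ {x y w vs} → CoverPath x y vs → w ∈ₗ x ∷ vs → x ≼ w × w ≼ y
  coverPath-between p (here refl) = ≼-refl , coverPath-≼ p
  coverPath-between (x⋖z ∷ p) (there w∈) =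
    Σ.map₁ (≼-trans (proj₁ (proj₁ x⋖z))) (coverPath-between p w∈)

  coverPath-unique : ∀ {x y vs} → CoverPath x y vs → Unique (x ∷ vs)
  coverPath-unique [] = [] ∷ []
  coverPath-unique p@(_ ∷ q) = All.map proj₂ (coverPath-above p) ∷ coverPath-unique q

  coverPath-comparable : ∀ {x y vs a b} → CoverPath x y vs → a ∈ₗ x ∷ vs → b ∈ₗ x ∷ vs →
                         a ≼ b ⊎ b ≼ a
  coverPath-comparable p (here refl) b∈ = inj₁ (proj₁ (coverPath-between p b∈))
  coverPath-comparable p (there a∈) (here refl) = inj₂ (proj₁ (coverPath-between p (there a∈)))
  coverPath-comparable (_ ∷ p) (there a∈) (there b∈) = coverPath-comparable p a∈ b∈

  coverPath-saturated : ∀ {x t vs d} → CoverPath x t vs → IsMaximal P t → x ≼ d →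
                        (∀ {w} → w ∈ₗ x ∷ vs → w ≼ d ⊎ d ≼ w) → d ∈ₗ x ∷ vs
  coverPath-saturated [] t-max t≼d _ = here (t-max _ t≼d)
  coverPath-saturated {d = d} (x⋖y ∷ p) t-max x≼d comparable with comparable (there (here refl))
  ... | inj₁ y≼d = there (coverPath-saturated p t-max y≼d (comparable ∘ there))
  ... | inj₂ d≼y = [ here , there ∘ here ]′ (proj₂ x⋖y d x≼d d≼y)

  record ChainPath (S : Subset n) : Set where
    field
      bottom top : Fin n
      vertices : List (Fin n)
      path : CoverPath bottom top vertices
      bottom-minimal : IsMinimal P bottom
      top-maximal : IsMaximal P top
      ∈⁺ : ∀ {z} → z ∈ₗ bottom ∷ vertices → z ∈ S
      ∈⁻ : ∀ {z} → z ∈ S → z ∈ₗ bottom ∷ vertices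

  chainPath : ∀ {b t vs} → CoverPath b t vs → IsMinimal P b → IsMaximal P t →
              ChainPath (fromList (b ∷ vs))
  chainPath p b-min t-max = record
    { path = p
    ; bottom-minimal = b-min
    ; top-maximal = t-max
    ; ∈⁺ = ∈-fromList⁺
    ; ∈⁻ = ∈-fromList⁻
    }

  chainPathThrough : Fin n → ∃ ChainPath
  chainPathThrough x with coverPathFromMinimal x | coverPathToMaximal x
  ... | _ , _ , b-min , p | _ , _ , t-max , q = _ , chainPath (p ++ₚ q) b-min t-max

  chainPath⇒maximalChain : ∀ {S} → ChainPath S → IsMaximalChain P S
  chainPath⇒maximalChain {S} cp = (⊆⊤ , λ a b → coverPath-comparable path (∈⁻ a) (∈⁻ b)) , maximal
    where
    open ChainPath cp
    maximal : ∀ D → IsChainIn P ⊤ D → S ⊆ D → D ⊆ S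
    maximal D (_ , D-chain) S⊆D {d} d∈D =
      ∈⁺ (coverPath-saturated path top-maximal bottom≼d comparable)
      where
      comparable : ∀ {w} → w ∈ₗ bottom ∷ vertices → w ≼ d ⊎ d ≼ w
      comparable w∈ = D-chain (S⊆D (∈⁺ w∈)) d∈D
      bottom≼d : bottom ≼ d
      bottom≼d = comparable⇒minimal≼ bottom-minimal (comparable (here refl))

  chain-greatest : ∀ {S D d} → IsChainIn P S D → d ∈ D → ∃[ m ] (m ∈ D × (∀ {x} → x ∈ D → x ≼ m))
  chain-greatest (_ , comparable) d∈D with maximalAbove _ d∈D
  ... | m , _ , m∈D , m-max = m , m∈D , λ x∈D → [ id , ≼-reflexive ∘ m-max x∈D ]′ (comparable x∈D m∈D)

  chain-least : ∀ {S D d} → IsChainIn P S D → d ∈ D → ∃[ m ] (m ∈ D × (∀ {x} → x ∈ D → m ≼ x))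
  chain-least (_ , comparable) d∈D with minimalBelow _ d∈D
  ... | m , _ , m∈D , m-min =
    m , m∈D , λ x∈D → [ ≼-reflexive ∘ sym ∘ m-min x∈D , id ]′ (comparable x∈D m∈D)

  maximalChainIn-absorbs : ∀ {S D t} → IsMaximalChainIn P S D → t ∈ S →
                           (∀ {d} → d ∈ D → d ≼ t ⊎ t ≼ d) → t ∈ D
  maximalChainIn-absorbs {S} {D} {t} ((D⊆S , D-chain) , D-max) t∈S t-comparable =
    D-max (D ∪ ⁅ t ⁆) (D+t⊆S , D+t-chain) (p⊆p∪q ⁅ t ⁆) (x∈p∪q⁺ (inj₂ (x∈⁅x⁆ t)))
    where
    ∈-D+t : ∀ {x} → x ∈ D ∪ ⁅ t ⁆ → x ∈ D ⊎ x ≡ t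
    ∈-D+t x∈ = Sum.map₂ (x∈⁅y⁆⇒x≡y t) (x∈p∪q⁻ D ⁅ t ⁆ x∈)
    D+t⊆S : D ∪ ⁅ t ⁆ ⊆ S
    D+t⊆S x∈ with ∈-D+t x∈
    ... | inj₁ x∈D = D⊆S x∈D
    ... | inj₂ refl = t∈S
    D+t-chain : ∀ {x y} → x ∈ D ∪ ⁅ t ⁆ → y ∈ D ∪ ⁅ t ⁆ → x ≼ y ⊎ y ≼ x
    D+t-chain x∈ y∈ with ∈-D+t x∈ | ∈-D+t y∈
    ... | inj₁ x∈D | inj₁ y∈D = D-chain x∈D y∈D
    ... | inj₁ x∈D | inj₂ refl = t-comparable x∈D
    ... | inj₂ refl | inj₁ y∈D = Sum.swap (t-comparable y∈D)
    ... | inj₂ refl | inj₂ refl = inj₁ ≼-refl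

module Hasse {n : ℕ} (P : FinPoset n) where
  open Order P

  PathIn : Subset n → Fin n → Fin n → Set
  PathIn W x y = ∃[ vs ] (Path (HasseAdj P) x y vs × All (_∈ W) vs)

  Connected : Subset n → Set
  Connected W = ∀ {x y} → x ∈ W → y ∈ W → PathIn W x y

  _++ᵂ_ : ∀ {W x y z} → PathIn W x y → PathIn W y z → PathIn W x z
  (as , p , as∈W) ++ᵂ (bs , q , bs∈W) = as ++ bs , p ++ₚ q , Allₚ.++⁺ as∈W bs∈W

  widen : ∀ {V W x y} → V ⊆ W → PathIn V x y → PathIn W x y
  widen V⊆W = Σ.map id (Σ.map id (All.map V⊆W))

  connected-∪ : ∀ {V W u} → Connected V → Connected W → u ∈ V → u ∈ W → Connected (V ∪ W)
  connected-∪ {V} {W} V-conn W-conn u∈V u∈W x∈ y∈ with x∈p∪q⁻ V W x∈ | x∈p∪q⁻ V W y∈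
  ... | inj₁ x∈V | inj₁ y∈V = widen (p⊆p∪q W) (V-conn x∈V y∈V)
  ... | inj₂ x∈W | inj₂ y∈W = widen (q⊆p∪q V W) (W-conn x∈W y∈W)
  ... | inj₁ x∈V | inj₂ y∈W =
    widen (p⊆p∪q W) (V-conn x∈V u∈V) ++ᵂ widen (q⊆p∪q V W) (W-conn u∈W y∈W)
  ... | inj₂ x∈W | inj₁ y∈V =
    widen (q⊆p∪q V W) (W-conn x∈W u∈W) ++ᵂ widen (p⊆p∪q W) (V-conn u∈V y∈V)

  coverPath-connected : ∀ {x y vs} → CoverPath x y vs → Connected (fromList (x ∷ vs))
  coverPath-connected {x} {y} {vs} p a∈ c∈ = toStart (∈-fromList⁻ a∈) ++ᵂ fromStart (∈-fromList⁻ c∈)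
    where
    fromStart : ∀ {a} → a ∈ₗ x ∷ vs → PathIn (fromList (x ∷ vs)) x a
    fromStart a∈ = Σ.map id (Σ.map₁ (mapₚ inj₁))
                          (prefix (All.tabulate (∈-fromList⁺ {xs = x ∷ vs} ∘ there)) p a∈)
    toStart : ∀ {a} → a ∈ₗ x ∷ vs → PathIn (fromList (x ∷ vs)) a x
    toStart a∈ with fromStart a∈
    ... | _ , q , as∈ = reverse Sum.swap (∈-fromList⁺ {xs = x ∷ vs} (here refl)) as∈ q

  connected-⊆⊇ : ∀ {V W} → V ⊆ W → W ⊆ V → Connected V → Connected W
  connected-⊆⊇ V⊆W W⊆V V-conn x∈ y∈ = widen V⊆W (V-conn (W⊆V x∈) (W⊆V y∈))

  chainPath-connected : ∀ {S} → ChainPath S → Connected S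
  chainPath-connected cp =
    connected-⊆⊇ (∈⁺ ∘ ∈-fromList⁻) (∈-fromList⁺ ∘ ∈⁻) (coverPath-connected path)
    where open ChainPath cp

  walk-leaves : ∀ {U x z} → Walk P x z → x ∈ U → z ∉ U →
                ∃[ u ] ∃[ v ] (u ∈ U × v ∉ U × HasseAdj P u v)
  walk-leaves here x∈U z∉U = ⊥-elim (z∉U x∈U)
  walk-leaves {U} {x} (step {y = y} x~y w) x∈U z∉U with y ∈? U
  ... | yes y∈U = walk-leaves w y∈U z∉U
  ... | no y∉U = x , y , x∈U , y∉U , x~y

module Tree {n : ℕ} (P : FinPoset n) (acyclic : ¬ HasseCycle P) where
  open Order P
  open Hasse P

  -- The cycle runs from z up to y, back to x inside W, and up to z again.
  noExcursion : ∀ {W x z y vs} → Connected W → x ∈ W → y ∈ W → x ⋖ z → CoverPath z y (vs ++ [ y ]) →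
                ¬ All (_∉ W) (z ∷ vs)
  noExcursion {W} {x} {z} {y} {vs} W-conn x∈W y∈W x⋖z p zvs∉W with W-conn y∈W x∈W
  ... | _ , q , qs∈W with eraseLoops _≟_ qs∈W q
  ... | [] , [] , _ , _ = ≺⇒⋡ (proj₁ x⋖z) (coverPath-≼ p)
  ... | ws@(_ ∷ ws′) , q′ , y∉ws ∷ ws-unique , ws∈W =
    acyclic (z , (vs ++ [ y ]) ++ ws , 2≤length vs ws′ ,
             Uniqueₚ.++⁺ (coverPath-unique p) ws-unique disjoint , closed)
    where
    disjoint : Disjoint (z ∷ vs ++ [ y ]) ws
    disjoint (v∈p , v∈ws) with ∈-++⁻ (z ∷ vs) v∈p
    ... | inj₁ v∈zvs = All.lookup zvs∉W v∈zvs (All.lookup ws∈W v∈ws)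
    ... | inj₂ (here refl) = All.lookup y∉ws v∈ws refl
    closed : Linked (HasseAdj P) (z ∷ ((vs ++ [ y ]) ++ ws) ++ [ z ])
    closed = subst (Linked _ ∘ (z ∷_)) (sym (++-assoc (vs ++ [ y ]) ws [ z ]))
                   (linked (mapₚ inj₁ p ++ₚ (q′ ++ₚ (inj₁ x⋖z ∷ []))))

  coverPath-inside : ∀ {W x y vs} → Connected W → x ∈ W → y ∈ W → CoverPath x y vs → All (_∈ W) vs
  coverPath-inside W-conn x∈W y∈W [] = []
  coverPath-inside {W} W-conn x∈W y∈W (_∷_ {y = z} x⋖z p) with z ∈? W
  ... | yes z∈W = z∈W ∷ coverPath-inside W-conn z∈W y∈W p
  ... | no z∉W with firstIn (_∈? W) z∉W y∈W p
  ...   | _ , _ , y′∈W , p′ , bs∉W = ⊥-elim (noExcursion W-conn x∈W y′∈W x⋖z p′ (z∉W ∷ bs∉W))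

  connected⇒convex : ∀ {W x y z} → Connected W → x ∈ W → y ∈ W → x ≼ z → z ≼ y → z ∈ W
  connected⇒convex W-conn x∈W y∈W x≼z z≼y with coverPath x≼z | coverPath z≼y
  ... | _ , p | _ , q =
    All.lookup (x∈W ∷ coverPath-inside W-conn x∈W y∈W (p ++ₚ q)) (∈-++⁺ˡ (target∈ p))

  coverPath-interval : ∀ {x y vs} → CoverPath x y vs → IsInterval P (fromList (x ∷ vs))
  coverPath-interval {x} {y} {vs} p = x , y , λ z → coverPath-between p ∘ ∈-fromList⁻ ,
    connected⇒convex (coverPath-connected p) (∈-fromList⁺ {xs = x ∷ vs} (here refl))
                     (∈-fromList⁺ (target∈ p))

  maximalChainIn⇒maximalChain : ∀ {U D} → Connected U → Nonempty U → BoundedByExtrema U →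
                                IsMaximalChainIn P U D → IsMaximalChain P D
  maximalChainIn⇒maximalChain {U} {D} U-conn (r , r∈U) bounded D-max@((D⊆U , D-chain) , D-maximal) =
    (⊆⊤ , D-chain) , maximal
    where
    D-nonempty : Nonempty D
    D-nonempty with nonempty? D
    ... | yes D≢∅ = D≢∅
    ... | no D≡∅ = r , maximalChainIn-absorbs D-max r∈U (λ d∈D → ⊥-elim (D≡∅ (_ , d∈D)))

    top : ∃[ t ] (t ∈ D × IsMaximal P t)
    top with chain-greatest (D⊆U , D-chain) (proj₂ D-nonempty)
    ... | m , m∈D , ≼m with proj₂ (bounded (D⊆U m∈D))
    ...   | t , t∈U , m≼t , t-max =
      t , maximalChainIn-absorbs D-max t∈U (λ d∈D → inj₁ (≼-trans (≼m d∈D) m≼t)) , t-max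

    bottom : ∃[ b ] (b ∈ D × IsMinimal P b)
    bottom with chain-least (D⊆U , D-chain) (proj₂ D-nonempty)
    ... | m , m∈D , m≼ with proj₁ (bounded (D⊆U m∈D))
    ...   | b , b∈U , b≼m , b-min =
      b , maximalChainIn-absorbs D-max b∈U (λ d∈D → inj₂ (≼-trans b≼m (m≼ d∈D))) , b-min

    maximal : ∀ E → IsChainIn P ⊤ E → D ⊆ E → E ⊆ D
    maximal E (_ , E-chain) D⊆E {e} e∈E with e ∈? U | top | bottom
    ... | yes e∈U | _ | _ =
      D-maximal (E ∩ U) (p∩q⊆q E U , λ a b → E-chain (p∩q⊆p E U a) (p∩q⊆p E U b))
                (λ d∈D → x∈p∩q⁺ (D⊆E d∈D , D⊆U d∈D)) (x∈p∩q⁺ (e∈E , e∈U))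
    ... | no e∉U | t , t∈D , t-max | b , b∈D , b-min =
      ⊥-elim (e∉U (connected⇒convex U-conn (D⊆U b∈D) (D⊆U t∈D)
        (comparable⇒minimal≼ b-min (E-chain (D⊆E b∈D) e∈E))
        (comparable⇒≼maximal t-max (E-chain e∈E (D⊆E t∈D)))))

module Graded {n : ℕ} (P : FinPoset n) (acyclic : ¬ HasseCycle P) {k : ℕ}
              (graded : IsGraded P ⊤) (height : HasHeight P ⊤ k) where
  open Order P
  open Hasse P
  open Tree P acyclic

  longestChain-maximal : ∀ {K} → IsChainIn P ⊤ K → ∣ K ∣ ≡ k → IsMaximalChain P K
  longestChain-maximal K-chain ∣K∣≡k = K-chain , λ D D-chain K⊆D →
    p⊆q∧∣q∣≤∣p∣⇒q⊆p K⊆D (subst (∣ D ∣ ≤_) (sym ∣K∣≡k) (proj₂ height D D-chain))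

  maximalChain-size : ∀ {M} → IsMaximalChain P M → ∣ M ∣ ≡ k
  maximalChain-size {M} M-max with proj₁ height
  ... | K , K-chain , ∣K∣≡k = trans (graded M K M-max (longestChain-maximal K-chain ∣K∣≡k)) ∣K∣≡k

  connected⇒graded : ∀ {U M} → Connected U → Nonempty U → BoundedByExtrema U →
                     M ⊆ U → IsMaximalChain P M → IsGraded P U × HasHeight P U k
  connected⇒graded {U} U-conn U≢∅ bounded M⊆U M-max =
    (λ C D C-max D-max → trans (size C-max) (sym (size D-max))) ,
    (_ , (M⊆U , proj₂ (proj₁ M-max)) , maximalChain-size M-max) ,
    λ C C-chain → proj₂ height C (⊆⊤ , proj₂ C-chain)
    where
    size : ∀ {C} → IsMaximalChainIn P U C → ∣ C ∣ ≡ k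
    size = maximalChain-size ∘ maximalChainIn⇒maximalChain U-conn U≢∅ bounded

  unionOfChainPaths-graded : ∀ {C : ℕ → Subset n} {j} → 1 ≤ j →
                             (∀ i → 1 ≤ i → i ≤ j → ChainPath (C i)) → Connected (unionUpTo C j) →
                             IsGraded P (unionUpTo C j) × HasHeight P (unionUpTo C j) k
  unionOfChainPaths-graded {C} {j} 1≤j chains U-conn =
    connected⇒graded U-conn (_ , C₁⊆U (ChainPath.∈⁺ C₁ (here refl))) bounded
                     C₁⊆U (chainPath⇒maximalChain C₁)
    where
    C₁ : ChainPath (C 1)
    C₁ = chains 1 ≤-refl 1≤j
    C₁⊆U : C 1 ⊆ unionUpTo C j
    C₁⊆U = ∈-unionUpTo⁺ C ≤-refl 1≤j
    bounded : BoundedByExtrema (unionUpTo C j)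
    bounded {u} u∈ with ∈-unionUpTo⁻ C j u∈
    ... | i , 1≤i , i≤j , u∈Ci =
      (bottom , ⊆U (here refl) , proj₁ b≼u≼t , bottom-minimal) ,
      (top , ⊆U (target∈ path) , proj₂ b≼u≼t , top-maximal)
      where
      open ChainPath (chains i 1≤i i≤j)
      ⊆U : ∀ {z} → z ∈ₗ bottom ∷ vertices → z ∈ unionUpTo C j
      ⊆U = ∈-unionUpTo⁺ C 1≤i i≤j ∘ ∈⁺
      b≼u≼t : bottom ≼ u × u ≼ top
      b≼u≼t = coverPath-between path (∈⁻ u∈Ci)

module Decomposition {n : ℕ} (P : FinPoset n) (acyclic : ¬ HasseCycle P) where
  open Order P
  open Hasse P
  open Tree P acyclic

  IsExtremalInterval : Subset n → Set
  IsExtremalInterval I = Nonempty I × IsInterval P I × ∃[ x ] (x ∈ I × (IsMinimal P x ⊎ IsMaximal P x))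

  -- Conditions (ii) and (iii) for C 1, …, C ℓ. In place of (i) the partial unions are required to be
  -- Hasse-connected, which makes them convex and hence graded (unionOfChainPaths-graded).
  record IsPartialDecomposition (ℓ : ℕ) (C : ℕ → Subset n) : Set where
    field
      1≤ℓ : 1 ≤ ℓ
      chains : ∀ i → 1 ≤ i → i ≤ ℓ → ChainPath (C i)
      connected : ∀ j → 1 ≤ j → j ≤ ℓ → Connected (unionUpTo C j)
      intervals : ∀ j → 1 < j → j ≤ ℓ → IsExtremalInterval (newPart C j)
      overlaps : ∀ j → 1 < j → j ≤ ℓ → ∃[ i ] (1 ≤ i × i < j × (C j ─ newPart C j) ⊆ C i)

  single : ∀ {S} → ChainPath S → IsPartialDecomposition 1 (λ _ → S)
  single {S} cp = record
    { 1≤ℓ = ≤-refl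
    ; chains = λ _ _ _ → cp
    ; connected = connected
    ; intervals = λ j 1<j j≤1 → ⊥-elim (<⇒≱ 1<j j≤1)
    ; overlaps = λ j 1<j j≤1 → ⊥-elim (<⇒≱ 1<j j≤1)
    }
    where
    connected : ∀ j → 1 ≤ j → j ≤ 1 → Connected (unionUpTo (λ _ → S) j)
    connected 1 _ _ = subst Connected (sym (∪-identityˡ S)) (chainPath-connected cp)
    connected (suc (suc _)) _ (s≤s ())

  module Step {ℓ C} (D : IsPartialDecomposition ℓ C) where
    open IsPartialDecomposition D

    U : Subset n
    U = unionUpTo C ℓ

    U-connected : Connected U
    U-connected = connected ℓ 1≤ℓ ≤-refl

    U-nonempty : Nonempty U
    U-nonempty = _ , ∈-unionUpTo⁺ C ≤-refl 1≤ℓ (ChainPath.∈⁺ (chains 1 ≤-refl 1≤ℓ) (here refl))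

    module _ {N : Subset n} where

      C′ : ℕ → Subset n
      C′ = C [ suc ℓ ]≔ N

      unchanged : ∀ {i} → i ≤ ℓ → C′ i ≡ C i
      unchanged i≤ℓ = []≔-unchanged C N (<⇒≢ (s≤s i≤ℓ))

      unionUpTo-unchanged : ∀ {j} → j ≤ ℓ → unionUpTo C′ j ≡ unionUpTo C j
      unionUpTo-unchanged j≤ℓ = unionUpTo-cong _ (λ i≤j → unchanged (≤-trans i≤j j≤ℓ))

      newPart-unchanged : ∀ {j} → j ≤ ℓ → newPart C′ j ≡ newPart C j
      newPart-unchanged j≤ℓ = newPart-cong _ (λ i≤j → unchanged (≤-trans i≤j j≤ℓ))

      unionUpTo-new : unionUpTo C′ (suc ℓ) ≡ U ∪ N
      unionUpTo-new = cong₂ _∪_ (unionUpTo-unchanged ≤-refl) ([]≔-updated C (suc ℓ) N)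

      newPart-new : newPart C′ (suc ℓ) ≡ N ─ U
      newPart-new = cong₂ _─_ ([]≔-updated C (suc ℓ) N) (unionUpTo-unchanged ≤-refl)

      extend : ∀ {u i} → ChainPath N → u ∈ U → u ∈ N → 1 ≤ i → i ≤ ℓ →
               IsExtremalInterval (N ─ U) → N ─ (N ─ U) ⊆ C i → IsPartialDecomposition (suc ℓ) C′
      extend N-chain u∈U u∈N 1≤i i≤ℓ N-interval N-overlap = record
        { 1≤ℓ = s≤s z≤n
        ; chains = chains′
        ; connected = connected′
        ; intervals = intervals′
        ; overlaps = overlaps′
        }
        where
        chains′ : ∀ i → 1 ≤ i → i ≤ suc ℓ → ChainPath (C′ i)
        chains′ i 1≤i i≤1+ℓ with m≤1+n⇒m≤n⊎m≡1+n i≤1+ℓ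
        ... | inj₁ i≤ℓ = subst ChainPath (sym (unchanged i≤ℓ)) (chains i 1≤i i≤ℓ)
        ... | inj₂ refl = subst ChainPath (sym ([]≔-updated C (suc ℓ) N)) N-chain

        connected′ : ∀ j → 1 ≤ j → j ≤ suc ℓ → Connected (unionUpTo C′ j)
        connected′ j 1≤j j≤1+ℓ with m≤1+n⇒m≤n⊎m≡1+n j≤1+ℓ
        ... | inj₁ j≤ℓ = subst Connected (sym (unionUpTo-unchanged j≤ℓ)) (connected j 1≤j j≤ℓ)
        ... | inj₂ refl = subst Connected (sym unionUpTo-new)
                                (connected-∪ U-connected (chainPath-connected N-chain) u∈U u∈N)

        intervals′ : ∀ j → 1 < j → j ≤ suc ℓ → IsExtremalInterval (newPart C′ j)
        intervals′ j 1<j j≤1+ℓ with m≤1+n⇒m≤n⊎m≡1+n j≤1+ℓ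
        ... | inj₁ j≤ℓ = subst IsExtremalInterval (sym (newPart-unchanged j≤ℓ)) (intervals j 1<j j≤ℓ)
        ... | inj₂ refl = subst IsExtremalInterval (sym newPart-new) N-interval

        overlaps′ : ∀ j → 1 < j → j ≤ suc ℓ → ∃[ i ] (1 ≤ i × i < j × (C′ j ─ newPart C′ j) ⊆ C′ i)
        overlaps′ j 1<j j≤1+ℓ with m≤1+n⇒m≤n⊎m≡1+n j≤1+ℓ
        ... | inj₁ j≤ℓ = Σ.map id (λ (1≤i , i<j , ⊆Ci) → 1≤i , i<j , λ {z} →
                subst (z ∈_) (sym (unchanged (≤-trans (<⇒≤ i<j) j≤ℓ)))
              ∘ ⊆Ci ∘ subst (z ∈_) (cong₂ _─_ (unchanged j≤ℓ) (newPart-unchanged j≤ℓ)))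
              (overlaps j 1<j j≤ℓ)
        ... | inj₂ refl = _ , 1≤i , s≤s i≤ℓ , λ {z} →
                subst (z ∈_) (sym (unchanged i≤ℓ)) ∘ N-overlap
              ∘ subst (z ∈_) (cong₂ _─_ ([]≔-updated C (suc ℓ) N) newPart-new)

      extend-grows : Nonempty (N ─ U) → U ⊂ unionUpTo C′ (suc ℓ)
      extend-grows (v , v∈N─U) = subst (U ⊂_) (sym unionUpTo-new)
        (p⊆p∪q N , v , q⊆p∪q U N (p─q⊆p N U v∈N─U) , x∈p─q⇒x∉q N U v∈N─U)

    Extension : ℕ → Fin n → Set
    Extension i u = ∃[ N ] (ChainPath N × u ∈ N × IsExtremalInterval (N ─ U) × N ─ (N ─ U) ⊆ C i)

    spliced : ∀ {i u N L} → C i ⊆ U → ChainPath N → u ∈ N → N ⊆ L ∪ C i → L ⊆ N →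
              (∀ {z} → z ∈ L → z ∉ U) → IsExtremalInterval L → Extension i u
    spliced {i} {N = N} {L} Ci⊆U N-chain u∈N N⊆L∪Ci L⊆N L∩U≡∅ L-interval =
      N , N-chain , u∈N , subst IsExtremalInterval (sym N─U≡L) L-interval ,
      subst (λ X → N ─ X ⊆ C i) (sym N─U≡L) (p⊆q∪r⇒p─q⊆r N⊆L∪Ci)
      where
      N─U≡L : N ─ U ≡ L
      N─U≡L = p⊆q∪r⇒p─s≡q N⊆L∪Ci L⊆N L∩U≡∅ Ci⊆U

    module _ {i u} (Ci-chain : ChainPath (C i)) (Ci⊆U : C i ⊆ U) (u∈Ci : u ∈ C i) where
      open ChainPath Ci-chain

      upward : ∀ {v} → v ∉ U → u ⋖ v → Extension i u
      upward {v} v∉U u⋖v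
        with prefix (All.tabulate (∈⁺ ∘ there)) path (∈⁻ u∈Ci) | coverPathToMaximal v
      ... | pre , b→u , pre∈Ci | m , up , m-max , v→m =
        spliced Ci⊆U N-chain u∈N N⊆L∪Ci (fromList-++⁺ʳ (bottom ∷ pre) (v ∷ up)) L∩U≡∅ L-interval
        where
        N-chain : ChainPath (fromList (bottom ∷ pre ++ v ∷ up))
        N-chain = chainPath (b→u ++ₚ (u⋖v ∷ v→m)) bottom-minimal m-max
        u∈N : u ∈ fromList (bottom ∷ pre ++ v ∷ up)
        u∈N = fromList-++⁺ˡ (bottom ∷ pre) (v ∷ up) (∈-fromList⁺ (target∈ b→u))
        N⊆L∪Ci : fromList (bottom ∷ pre ++ v ∷ up) ⊆ fromList (v ∷ up) ∪ C i
        N⊆L∪Ci z∈ with ∈-++⁻ (bottom ∷ pre) (∈-fromList⁻ z∈)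
        ... | inj₁ z∈pre = x∈p∪q⁺ (inj₂ (All.lookup (∈⁺ (here refl) ∷ pre∈Ci) z∈pre))
        ... | inj₂ z∈up = x∈p∪q⁺ (inj₁ (∈-fromList⁺ z∈up))
        L∩U≡∅ : ∀ {z} → z ∈ fromList (v ∷ up) → z ∉ U
        L∩U≡∅ z∈L z∈U = v∉U (connected⇒convex U-connected (Ci⊆U u∈Ci) z∈U
          (proj₁ (proj₁ u⋖v)) (proj₁ (coverPath-between v→m (∈-fromList⁻ z∈L))))
        L-interval : IsExtremalInterval (fromList (v ∷ up))
        L-interval = (v , ∈-fromList⁺ {xs = v ∷ up} (here refl)) , coverPath-interval v→m ,
                     m , ∈-fromList⁺ (target∈ v→m) , inj₂ m-max

      downward : ∀ {v} → v ∉ U → v ⋖ u → Extension i u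
      downward {v} v∉U v⋖u
        with suffix (All.tabulate (∈⁺ ∘ there)) path (∈⁻ u∈Ci) | coverPathFromMinimal v
      ... | suf , u→t , suf∈Ci | m , dn , m-min , m→v =
        spliced Ci⊆U N-chain u∈N N⊆L∪Ci (fromList-++⁺ˡ (m ∷ dn) (u ∷ suf)) L∩U≡∅ L-interval
        where
        N-chain : ChainPath (fromList (m ∷ dn ++ u ∷ suf))
        N-chain = chainPath (m→v ++ₚ (v⋖u ∷ u→t)) m-min top-maximal
        u∈N : u ∈ fromList (m ∷ dn ++ u ∷ suf)
        u∈N = fromList-++⁺ʳ (m ∷ dn) (u ∷ suf) (∈-fromList⁺ {xs = u ∷ suf} (here refl))
        N⊆L∪Ci : fromList (m ∷ dn ++ u ∷ suf) ⊆ fromList (m ∷ dn) ∪ C i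
        N⊆L∪Ci z∈ with ∈-++⁻ (m ∷ dn) (∈-fromList⁻ z∈)
        ... | inj₁ z∈dn = x∈p∪q⁺ (inj₁ (∈-fromList⁺ z∈dn))
        ... | inj₂ z∈suf = x∈p∪q⁺ (inj₂ (All.lookup (u∈Ci ∷ suf∈Ci) z∈suf))
        L∩U≡∅ : ∀ {z} → z ∈ fromList (m ∷ dn) → z ∉ U
        L∩U≡∅ z∈L z∈U = v∉U (connected⇒convex U-connected z∈U (Ci⊆U u∈Ci)
          (proj₂ (coverPath-between m→v (∈-fromList⁻ z∈L))) (proj₁ (proj₁ v⋖u)))
        L-interval : IsExtremalInterval (fromList (m ∷ dn))
        L-interval = (m , m∈L) , coverPath-interval m→v , m , m∈L , inj₁ m-min
          where
          m∈L : m ∈ fromList (m ∷ dn)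
          m∈L = ∈-fromList⁺ {xs = m ∷ dn} (here refl)

      extension : ∀ {v} → v ∉ U → HasseAdj P u v → Extension i u
      extension v∉U = [ upward v∉U , downward v∉U ]′

    extendBy : ∀ {i u} → 1 ≤ i → i ≤ ℓ → u ∈ U → Extension i u →
               ∃[ C′ ] (IsPartialDecomposition (suc ℓ) C′ × U ⊂ unionUpTo C′ (suc ℓ))
    extendBy 1≤i i≤ℓ u∈U (N , N-chain , u∈N , N-interval , N-overlap) =
      _ , extend N-chain u∈U u∈N 1≤i i≤ℓ N-interval N-overlap , extend-grows (proj₁ N-interval)

    grow : HasseConnected P →
           (∀ x → x ∈ U) ⊎ ∃[ C′ ] (IsPartialDecomposition (suc ℓ) C′ × U ⊂ unionUpTo C′ (suc ℓ))
    grow hasse-conn with all? (_∈? U)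
    ... | yes all∈U = inj₁ all∈U
    ... | no ¬all∈U with ¬∀⟶∃¬ n _ (_∈? U) ¬all∈U
    ... | v₀ , v₀∉U with walk-leaves (hasse-conn (proj₁ U-nonempty) v₀) (proj₂ U-nonempty) v₀∉U
    ... | u , v , u∈U , v∉U , u~v with ∈-unionUpTo⁻ C ℓ u∈U
    ... | i , 1≤i , i≤ℓ , u∈Ci =
      inj₂ (extendBy 1≤i i≤ℓ u∈U
              (extension (chains i 1≤i i≤ℓ) (∈-unionUpTo⁺ C 1≤i i≤ℓ) u∈Ci v∉U u~v))

  decompose : HasseConnected P → ∀ {ℓ C} → IsPartialDecomposition ℓ C → Acc _⊃_ (unionUpTo C ℓ) →
              ∃[ ℓ ] ∃[ C ] (IsPartialDecomposition ℓ C × unionUpTo C ℓ ≡ ⊤)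
  decompose hasse-conn D (acc rec) with Step.grow D hasse-conn
  ... | inj₁ all∈U = _ , _ , D , ⊆-antisym ⊆⊤ (λ {x} _ → all∈U x)
  ... | inj₂ (_ , D′ , U⊂U′) = decompose hasse-conn D′ (rec U⊂U′)

  decomposition : HasseConnected P → Fin n →
                  ∃[ ℓ ] ∃[ C ] (IsPartialDecomposition ℓ C × unionUpTo C ℓ ≡ ⊤)
  decomposition hasse-conn x = decompose hasse-conn (single (proj₂ (chainPathThrough x))) (⊃-wellFounded _)

lemma2p8 : {n : ℕ} (P : FinPoset n) (k : ℕ) →
    IsTreePoset P → IsGraded P ⊤ → HasHeight P ⊤ k →
    ∃[ ℓ ] ∃[ C ] (1 ≤ ℓ
      × (∀ i → 1 ≤ i → i ≤ ℓ → IsMaximalChain P (C i))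
      × ((∀ j → 1 ≤ j → j ≤ ℓ → IsGraded P (unionUpTo C j) × HasHeight P (unionUpTo C j) k)
         × unionUpTo C ℓ ≡ ⊤)
      × (∀ j → 1 < j → j ≤ ℓ →
           Nonempty (newPart C j) × IsInterval P (newPart C j)
           × ∃[ x ] (x ∈ newPart C j × (IsMinimal P x ⊎ IsMaximal P x)))
      × (∀ j → 1 < j → j ≤ ℓ →
           ∃[ i ] (1 ≤ i × i < j × (C j ─ newPart C j) ⊆ C i)))
lemma2p8 P k (0<n , hasse-conn , acyclic) graded height
  with Decomposition.decomposition P acyclic hasse-conn (fromℕ< 0<n)
... | ℓ , C , D , U≡⊤ =
  ℓ , C , 1≤ℓ , (λ i 1≤i i≤ℓ → chainPath⇒maximalChain (chains i 1≤i i≤ℓ)) ,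
  (prefix-graded , U≡⊤) , intervals , overlaps
  where
  open Order P
  open Graded P acyclic graded height
  open Decomposition.IsPartialDecomposition D
  prefix-graded : ∀ j → 1 ≤ j → j ≤ ℓ → IsGraded P (unionUpTo C j) × HasHeight P (unionUpTo C j) k
  prefix-graded j 1≤j j≤ℓ =
    unionOfChainPaths-graded 1≤j (λ i 1≤i i≤j → chains i 1≤i (≤-trans i≤j j≤ℓ)) (connected j 1≤j j≤ℓ)
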